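{- Let $(K_n,\Sigma)$ be a signed complete graph with $n\geq4$. For a sign $\Gamma\subseteq E(K_n)$, let $X(\Gamma)$ be the set of edges $vw$ such that the triangle $uvw$ is even in $(K_n,\Gamma)$ for every $u\in V(K_n)\setminus\{v,w\}$, and let $Y(\Gamma)$ be the set of edges $vw$ such that for every $u\in V(K_n)\setminus\{v,w\}$, $uvw$ is odd in $(K_n,\Gamma)$ and the number of odd triangles of $(K_n,\Gamma)$ containing $u$ and $v$ is one more than the number of even ones containing $u$ and $v$. If $Y(\Sigma)\neq\emptyset$, then $X(\Sigma)\cup Y(\Sigma)=X(\Sigma\triangle Y(\Sigma))$ and $Y(\Sigma\triangle Y(\Sigma))=\emptyset$.
   Context: A signed graph is a pair $(G,\Sigma)$ with $\Sigma\subseteq E(G)$; edges in $\Sigma$ are odd, others even. A triangle is odd (resp. even) if it contains an odd (resp. even) number of edges of the sign. $\triangle$ denotes symmetric difference. -}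

module Defs where

open import Data.Nat using (ℕ; _+_; _≡ᵇ_)
open import Data.Bool using (Bool; true; false; not; _∧_; _∨_; _xor_)
open import Data.Fin using (Fin; _≟_)
open import Data.List using (List; filterᵇ; length; foldr; allFin)
open import Relation.Nullary.Decidable using (⌊_⌋)
open import Relation.Binary.PropositionalEquality using (_≡_)

-- A sign Γ ⊆ E(K_n) on vertex set Fin n, given as its indicator on ordered
-- pairs: Γ v w ≡ true means the edge vw is in Γ (odd).  Only values on
-- pairs of distinct vertices are meaningful; genuine signs are symmetric.
Sign : ℕ → Set
Sign n = Fin n → Fin n → Bool

Symmetric : ∀ {n} → Sign n → Set
Symmetric s = ∀ v w → s v w ≡ s w v

allᵇ : {A : Set} → (A → Bool) → List A → Bool
allᵇ p = foldr (λ x b → p x ∧ b) true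

_△_ : ∀ {n} → Sign n → Sign n → Sign n
(s △ t) v w = s v w xor t v w

distinct : ∀ {n} → Fin n → Fin n → Bool
distinct a b = not ⌊ a ≟ b ⌋

others : ∀ {n} → Fin n → Fin n → List (Fin n)
others {n} v w = filterᵇ (λ u → distinct u v ∧ distinct u w) (allFin n)

oddTri : ∀ {n} → Sign n → Fin n → Fin n → Fin n → Bool
oddTri s u v w = (s u v xor s v w) xor s u w

oddCount : ∀ {n} → Sign n → Fin n → Fin n → ℕ
oddCount s u v = length (filterᵇ (λ x → oddTri s u v x) (others u v))

evenCount : ∀ {n} → Sign n → Fin n → Fin n → ℕ
evenCount s u v = length (filterᵇ (λ x → not (oddTri s u v x)) (others u v))

X : ∀ {n} → Sign n → Sign n
X s v w = distinct v w ∧ allᵇ (λ u → not (oddTri s u v w)) (others v w)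

Y : ∀ {n} → Sign n → Sign n
Y s v w = distinct v w ∧
  allᵇ (λ u → oddTri s u v w ∧ (oddCount s u v ≡ᵇ (evenCount s u v + 1))) (others v w)

-- Write Y for Y(Σ) and o(u,v) for the number of odd triangles containing u and v. If ab ∈ Y,
-- every triangle on ab is odd and o(u,a) = o(u,b) = (n - 1)/2 for every other vertex u; so Y is
-- symmetric, and it is a matching, since a second edge ac ∈ Y would also force o(c,a) = n - 2.
-- A handshake argument shows that (n - 1)/2 is odd.
-- Flipping Y makes every triangle on a Y-edge even and leaves the triangles on an X-edge alone,
-- so X ∪ Y ⊆ X(Σ △ Y). Conversely, on an edge vw ∉ Y of X(Σ △ Y) each triangle uvw of Σ has the
-- parity of Y(uv) + Y(uw); a Y-edge at v would then leave at most two odd triangles on wv, too few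
-- for the odd number (n - 1)/2 ≥ 3.
-- Finally let vw ∈ Y(Σ △ Y). If v is matched by Y, some triangle on vw becomes even. Otherwise
-- pick zz′ ∈ Y with z ≠ w: the flip lowers the number of odd triangles on zv by exactly one
-- (only zvz′ changes), yet both numbers must equal (n - 1)/2.

module Submission where

open import Defs
open import Algebra.Bundles using (CommutativeRing; CommutativeMonoid)
import Algebra.Properties.CommutativeSemigroup as CommSemigroupProperties
open import Data.Bool using (Bool; true; false; not; _∧_; _∨_; _xor_)
open import Data.Bool.Properties
  using ( ¬-not; not-injective; not-involutive; ∨-zeroʳ; ∧-zeroʳ; ∧-identityʳ; ∧-assoc; ∧-comm
        ; ∧-commutativeMonoid; xor-same; xor-assoc; xor-identityʳ; xor-∧-commutativeRing; T-∧; T-≡ )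
import Data.Bool.Properties as Bool
open import Data.Fin using (Fin; zero; suc; _≟_)
open import Data.Fin.Properties using (suc-injective; 0≢1+n; any?)
open import Data.Nat using (ℕ; zero; suc; _+_; _≤_; _<_; z≤n; s≤s; ⌊_/2⌋)
open import Data.Nat.Tactic.RingSolver using (solve-∀)
open import Data.Nat.Properties
  using ( +-comm; +-assoc; +-suc; +-cancelˡ-≡; +-mono-≤; +-commutativeSemigroup; ≡ᵇ⇒≡; ≡⇒≡ᵇ
        ; ≤-trans; ≤-reflexive; <-irrefl; <⇒≢; <⇒≤; 1+n≢n; n≡⌊n+n/2⌋ )
import Data.Nat.Properties as ℕ
open import Data.Empty using (⊥; ⊥-elim)
open import Data.Sum using (_⊎_; inj₁; inj₂; [_,_])
open import Data.List using (List; []; _∷_; filterᵇ; length; allFin; tabulate)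
open import Data.List.Membership.Propositional using (_∈_)
open import Data.List.Membership.Propositional.Properties using (∈-filter⁺; ∈-filter⁻; ∈-allFin)
open import Data.List.Relation.Unary.Any using (here; there)
open import Data.Product using (_×_; _,_; proj₁; proj₂; map₁; ∃; ∃₂)
open import Function using (_∘_; id; Equivalence; case_of_)
open import Relation.Nullary using (yes; no)
open import Relation.Nullary.Decidable using (T?; fromWitnessFalse; toWitnessFalse)
open import Relation.Binary.PropositionalEquality hiding ([_])
open ≡-Reasoning

module ℕ+ = CommSemigroupProperties +-commutativeSemigroup
module ∧-CS = CommSemigroupProperties (CommutativeMonoid.commutativeSemigroup ∧-commutativeMonoid)
module Xor = CommSemigroupProperties (CommutativeRing.+-commutativeSemigroup xor-∧-commutativeRing)

∧-true⁻ : ∀ {a b} → a ∧ b ≡ true → a ≡ true × b ≡ true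
∧-true⁻ {true} b≡true = refl , b≡true

false≢true : false ≢ true
false≢true ()

∨-true⁻ : ∀ {a b} → a ∨ b ≡ true → a ≡ true ⊎ b ≡ true
∨-true⁻ {true}  _ = inj₁ refl
∨-true⁻ {false} b = inj₂ b

∧-redundantʳ : ∀ {a b} → (a ≡ true → b ≡ true) → a ∧ b ≡ a
∧-redundantʳ {true}  a⇒b = a⇒b refl
∧-redundantʳ {false} _   = refl

≡-by-true : ∀ {a b} → (a ≡ true → b ≡ true) → (b ≡ true → a ≡ true) → a ≡ b
≡-by-true {true}          a⇒b _   = sym (a⇒b refl)
≡-by-true {false} {true}  _   b⇒a = b⇒a refl
≡-by-true {false} {false} _   _   = refl

xor-cancelʳ : ∀ a b c → (a xor c) xor (b xor c) ≡ a xor b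
xor-cancelʳ a b c = begin
  (a xor c) xor (b xor c) ≡⟨ Xor.interchange a c b c ⟩
  (a xor b) xor (c xor c) ≡⟨ cong ((a xor b) xor_) (xor-same c) ⟩
  (a xor b) xor false     ≡⟨ xor-identityʳ (a xor b) ⟩
  a xor b                 ∎

xor≡false⇒≡ : ∀ {a b} → a xor b ≡ false → a ≡ b
xor≡false⇒≡ {true}  {true}  _ = refl
xor≡false⇒≡ {false} {false} _ = refl

distinct-≢ : ∀ {n} {a b : Fin n} → a ≢ b → distinct a b ≡ true
distinct-≢ {a = a} {b} a≢b with a ≟ b
... | yes a≡b = ⊥-elim (a≢b a≡b)
... | no _    = refl

distinct⇒≢ : ∀ {n} {a b : Fin n} → distinct a b ≡ true → a ≢ b
distinct⇒≢ {a = a} {b} d with a ≟ b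
... | yes _   = ⊥-elim (false≢true d)
... | no a≢b = a≢b

distinct-refl : ∀ {n} (a : Fin n) → distinct a a ≡ false
distinct-refl a with a ≟ a
... | yes _   = refl
... | no a≢a = ⊥-elim (a≢a refl)

distinct-sym : ∀ {n} (a b : Fin n) → distinct a b ≡ distinct b a
distinct-sym a b with a ≟ b | b ≟ a
... | yes _   | yes _   = refl
... | no _    | no _    = refl
... | yes a≡b | no b≢a  = ⊥-elim (b≢a (sym a≡b))
... | no a≢b  | yes b≡a = ⊥-elim (a≢b (sym b≡a))

distinct-suc : ∀ {n} (x a : Fin n) → distinct {suc n} (suc x) (suc a) ≡ distinct x a
distinct-suc x a with x ≟ a
... | yes _ = refl
... | no _  = refl

outside : ∀ {n} → Fin n → Fin n → Fin n → Bool
outside v w u = distinct u v ∧ distinct u w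

outside-true : ∀ {n} {u v x : Fin n} → x ≢ u → x ≢ v → outside u v x ≡ true
outside-true x≢u x≢v = cong₂ _∧_ (distinct-≢ x≢u) (distinct-≢ x≢v)

outside-true⁻ : ∀ {n} {u v x : Fin n} → outside u v x ≡ true → x ≢ u × x ≢ v
outside-true⁻ out with ∧-true⁻ out
... | x≉u , x≉v = distinct⇒≢ x≉u , distinct⇒≢ x≉v

toℕ : Bool → ℕ
toℕ false = 0
toℕ true  = 1

toℕ≤1 : ∀ b → toℕ b ≤ 1
toℕ≤1 true  = s≤s z≤n
toℕ≤1 false = z≤n

count : ∀ {n} → (Fin n → Bool) → ℕ
count {zero}  p = 0
count {suc n} p = toℕ (p zero) + count (p ∘ suc)

count-cong : ∀ {n} {p q : Fin n → Bool} → p ≗ q → count p ≡ count q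
count-cong {zero}  p≗q = refl
count-cong {suc n} p≗q = cong₂ _+_ (cong toℕ (p≗q zero)) (count-cong (p≗q ∘ suc))

count-true : ∀ {n} → count {n} (λ _ → true) ≡ n
count-true {zero}  = refl
count-true {suc n} = cong suc count-true

count-false : ∀ {n} {p : Fin n → Bool} → (∀ x → p x ≡ false) → count p ≡ 0
count-false {zero}  _ = refl
count-false {suc n} {p} p≡false rewrite p≡false zero = count-false (p≡false ∘ suc)

count-remove : ∀ {n} (p : Fin n → Bool) (a : Fin n) →
  count p ≡ toℕ (p a) + count (λ x → distinct x a ∧ p x)
count-remove {suc n} p zero    = refl
count-remove {suc n} p (suc a) = begin
  toℕ (p zero) + count (p ∘ suc)
    ≡⟨ cong (toℕ (p zero) +_) (count-remove (p ∘ suc) a) ⟩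
  toℕ (p zero) + (toℕ (p (suc a)) + count (λ x → distinct x a ∧ p (suc x)))
    ≡⟨ ℕ+.x∙yz≈y∙xz (toℕ (p zero)) (toℕ (p (suc a))) _ ⟩
  toℕ (p (suc a)) + (toℕ (p zero) + count (λ x → distinct x a ∧ p (suc x)))
    ≡⟨ cong (λ k → toℕ (p (suc a)) + (toℕ (p zero) + k))
            (count-cong (λ x → cong (_∧ p (suc x)) (sym (distinct-suc x a)))) ⟩
  toℕ (p (suc a)) + count (λ x → distinct x (suc a) ∧ p x) ∎

count-remove-guarded : ∀ {n} (g p : Fin n → Bool) {a} → g a ≡ true →
  count (λ x → g x ∧ p x) ≡ toℕ (p a) + count (λ x → (distinct x a ∧ g x) ∧ p x)
count-remove-guarded g p {a} ga = begin
  count (λ x → g x ∧ p x)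
    ≡⟨ count-remove (λ x → g x ∧ p x) a ⟩
  toℕ (g a ∧ p a) + count (λ x → distinct x a ∧ (g x ∧ p x))
    ≡⟨ cong₂ (λ b k → toℕ (b ∧ p a) + k) ga
             (count-cong (λ x → sym (∧-assoc (distinct x a) (g x) (p x)))) ⟩
  toℕ (p a) + count (λ x → (distinct x a ∧ g x) ∧ p x) ∎

count-guarded-cong : ∀ {n} {g g′ p q : Fin n → Bool} →
  g ≗ g′ → (∀ x → g x ≡ true → p x ≡ q x) →
  count (λ x → g x ∧ p x) ≡ count (λ x → g′ x ∧ q x)
count-guarded-cong {g = g} {p = p} {q} g≗g′ p≡q =
  count-cong λ x → trans (agree x (g x) refl) (cong (_∧ q x) (g≗g′ x))
  where
  agree : ∀ x b → g x ≡ b → b ∧ p x ≡ b ∧ q x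
  agree x true  gx = p≡q x gx
  agree x false _  = refl

toℕ-split : ∀ a b → toℕ (a ∧ b) + toℕ (a ∧ not b) ≡ toℕ a
toℕ-split true  true  = refl
toℕ-split true  false = refl
toℕ-split false _     = refl

count-split : ∀ {n} (p q : Fin n → Bool) →
  count (λ x → p x ∧ q x) + count (λ x → p x ∧ not (q x)) ≡ count p
count-split {zero}  p q = refl
count-split {suc n} p q = begin
  (toℕ (p zero ∧ q zero) + count (λ x → p (suc x) ∧ q (suc x)))
    + (toℕ (p zero ∧ not (q zero)) + count (λ x → p (suc x) ∧ not (q (suc x))))
    ≡⟨ ℕ+.interchange (toℕ (p zero ∧ q zero)) _ _ _ ⟩
  (toℕ (p zero ∧ q zero) + toℕ (p zero ∧ not (q zero)))
    + (count (λ x → p (suc x) ∧ q (suc x)) + count (λ x → p (suc x) ∧ not (q (suc x))))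
    ≡⟨ cong₂ _+_ (toℕ-split (p zero) (q zero)) (count-split (p ∘ suc) (q ∘ suc)) ⟩
  toℕ (p zero) + count (p ∘ suc) ∎

count-≤1 : ∀ {n} (p : Fin n → Bool) → (∀ x y → p x ≡ true → p y ≡ true → x ≡ y) →
  count p ≤ 1
count-≤1 {zero}  p _ = z≤n
count-≤1 {suc n} p unique with p zero in p0
... | true
  rewrite count-false {p = p ∘ suc} (λ x → ¬-not (0≢1+n ∘ unique zero (suc x) p0)) = s≤s z≤n
... | false = count-≤1 (p ∘ suc) (λ x y px py → suc-injective (unique (suc x) (suc y) px py))

count-outside : ∀ {n} {v w : Fin n} → v ≢ w → count (outside v w) + 2 ≡ n
count-outside {n} {v} {w} v≢w = begin
  count (outside v w) + 2                        ≡⟨ +-comm (count (outside v w)) 2 ⟩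
  suc (toℕ true + count (outside v w))
    ≡⟨ cong (λ b → suc (toℕ b + count (outside v w))) (distinct-≢ v≢w) ⟨
  suc (toℕ (distinct v w) + count (outside v w)) ≡⟨ cong suc (count-remove (λ x → distinct x w) v) ⟨
  suc (count (λ x → distinct x w))               ≡⟨ cong suc (count-cong (λ x → ∧-identityʳ (distinct x w))) ⟨
  suc (count (λ x → distinct x w ∧ true))        ≡⟨ count-remove (λ _ → true) w ⟨
  count {n} (λ _ → true)                         ≡⟨ count-true ⟩
  n ∎

search : ∀ {n} (p : Fin n → Bool) → (∃ λ x → p x ≡ true) ⊎ (∀ x → p x ≡ false)
search p with any? (T? ∘ p)
... | yes (x , px) = inj₁ (x , Equivalence.to T-≡ px)
... | no ∄x        = inj₂ λ x → ¬-not (∄x ∘ (x ,_) ∘ Equivalence.from T-≡)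

∃-outside : ∀ {n} {v w : Fin n} → 2 < n → v ≢ w → ∃ λ u → u ≢ v × u ≢ w
∃-outside {v = v} {w} 2<n v≢w with search (outside v w)
... | inj₁ (u , out) = u , outside-true⁻ out
... | inj₂ none      = ⊥-elim (<-irrefl refl (subst (2 <_) n≡2 2<n))
  where
  n≡2 = trans (sym (count-outside v≢w)) (cong (_+ 2) (count-false none))

odd : ℕ → Bool
odd zero    = false
odd (suc n) = not (odd n)

odd-toℕ-+ : ∀ b m → odd (toℕ b + m) ≡ b xor odd m
odd-toℕ-+ true  m = refl
odd-toℕ-+ false m = refl

odd-double : ∀ m → odd (m + m) ≡ false
odd-double zero    = refl
odd-double (suc m) rewrite +-suc m m = trans (not-involutive (odd (m + m))) (odd-double m)

odd-+2 : ∀ m → odd (m + 2) ≡ odd m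
odd-+2 m rewrite +-comm m 2 = not-involutive (odd m)

odd-count-xor : ∀ {n} (p q : Fin n → Bool) →
  odd (count (λ x → p x xor q x)) ≡ odd (count p) xor odd (count q)
odd-count-xor {zero}  p q = refl
odd-count-xor {suc n} p q = begin
  odd (toℕ (p zero xor q zero) + count (λ x → p (suc x) xor q (suc x)))
    ≡⟨ odd-toℕ-+ (p zero xor q zero) _ ⟩
  (p zero xor q zero) xor odd (count (λ x → p (suc x) xor q (suc x)))
    ≡⟨ cong ((p zero xor q zero) xor_) (odd-count-xor (p ∘ suc) (q ∘ suc)) ⟩
  (p zero xor q zero) xor (odd (count (p ∘ suc)) xor odd (count (q ∘ suc)))
    ≡⟨ Xor.interchange (p zero) (q zero) _ _ ⟩
  (p zero xor odd (count (p ∘ suc))) xor (q zero xor odd (count (q ∘ suc)))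
    ≡⟨ cong₂ _xor_ (odd-toℕ-+ (p zero) _) (odd-toℕ-+ (q zero) _) ⟨
  odd (count p) xor odd (count q) ∎

handshake : ∀ {n} (M : Fin n → Fin n → Bool) →
  (∀ x y → M x y ≡ M y x) → (∀ x → M x x ≡ false) →
  odd (count (λ x → odd (count (M x)))) ≡ false
handshake {zero}  M M-sym M-irr = refl
handshake {suc n} M M-sym M-irr = begin
  odd (count (λ x → odd (count (M x))))
    ≡⟨ odd-toℕ-+ (odd (count (M zero))) _ ⟩
  odd (count (M zero)) xor odd (count (λ u → odd (count (M (suc u)))))
    ≡⟨ cong₂ _xor_ (trans (odd-toℕ-+ (M zero zero) _) (cong (_xor d₀) (M-irr zero)))
                   (cong odd (count-cong (λ u → odd-toℕ-+ (M (suc u) zero) _))) ⟩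
  d₀ xor odd (count (λ u → M (suc u) zero xor odd (count (M′ u))))
    ≡⟨ cong (d₀ xor_) (odd-count-xor (λ u → M (suc u) zero) (λ u → odd (count (M′ u)))) ⟩
  d₀ xor (odd (count (λ u → M (suc u) zero)) xor rest)
    ≡⟨ cong (λ k → d₀ xor (odd k xor rest)) (count-cong (λ u → M-sym (suc u) zero)) ⟩
  d₀ xor (d₀ xor rest)  ≡⟨ xor-assoc d₀ d₀ rest ⟨
  (d₀ xor d₀) xor rest  ≡⟨ cong (_xor rest) (xor-same d₀) ⟩
  rest                  ≡⟨ handshake M′ (λ x y → M-sym (suc x) (suc y)) (M-irr ∘ suc) ⟩
  false                 ∎
  where
  M′ : Fin n → Fin n → Bool
  M′ x y = M (suc x) (suc y)
  d₀ rest : Bool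
  d₀   = odd (count (λ x → M zero (suc x)))
  rest = odd (count (λ u → odd (count (M′ u))))

balanced⇒half : ∀ {o e n} → o + e + 2 ≡ n → o ≡ e + 1 → suc (o + o) ≡ n
balanced⇒half {o} {e} total refl = trans (shuffle e) total
  where
  shuffle : ∀ e → suc ((e + 1) + (e + 1)) ≡ (e + 1) + e + 2
  shuffle = solve-∀

half⇒balanced : ∀ {o e n} → o + e + 2 ≡ n → suc (o + o) ≡ n → o ≡ e + 1
half⇒balanced {o} {e} total half =
  ℕ.suc-injective (trans (sym (+-cancelˡ-≡ o _ _ o+[e+2]≡o+suc-o)) (+-suc e 1))
  where
  o+[e+2]≡o+suc-o : o + (e + 2) ≡ o + suc o
  o+[e+2]≡o+suc-o = trans (sym (+-assoc o e 2)) (trans total (trans (sym half) (sym (+-suc o o))))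

double-injective : ∀ {m k} → m + m ≡ k + k → m ≡ k
double-injective {m} {k} eq =
  trans (n≡⌊n+n/2⌋ m) (trans (cong ⌊_/2⌋ eq) (sym (n≡⌊n+n/2⌋ k)))

half-unique : ∀ {m k n} → suc (m + m) ≡ n → suc (k + k) ≡ n → m ≡ k
half-unique m-half k-half = double-injective (ℕ.suc-injective (trans m-half (sym k-half)))

full-and-half⇒3 : ∀ {o n} → o + 2 ≡ n → suc (o + o) ≡ n → n ≡ 3
full-and-half⇒3 {o} refl half with +-cancelˡ-≡ o (suc o) 2 (trans (+-suc o o) half)
... | refl = refl

small-odd-half⇒3 : ∀ {o n} → odd o ≡ true → o ≤ 2 → suc (o + o) ≡ n → n ≡ 3
small-odd-half⇒3 {1}                 _ _                 refl = refl
small-odd-half⇒3 {suc (suc (suc _))} _ (s≤s (s≤s ())) _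

filterᵇ-filterᵇ : ∀ {A : Set} (p q : A → Bool) (xs : List A) →
  filterᵇ p (filterᵇ q xs) ≡ filterᵇ (λ x → q x ∧ p x) xs
filterᵇ-filterᵇ p q [] = refl
filterᵇ-filterᵇ p q (x ∷ xs) with q x
... | false = filterᵇ-filterᵇ p q xs
... | true with p x
...   | true  = cong (x ∷_) (filterᵇ-filterᵇ p q xs)
...   | false = filterᵇ-filterᵇ p q xs

length-filterᵇ-tabulate : ∀ {A : Set} {n} (p : A → Bool) (f : Fin n → A) →
  length (filterᵇ p (tabulate f)) ≡ count (p ∘ f)
length-filterᵇ-tabulate {n = zero}  p f = refl
length-filterᵇ-tabulate {n = suc n} p f with p (f zero)
... | true  = cong suc (length-filterᵇ-tabulate p (f ∘ suc))
... | false = length-filterᵇ-tabulate p (f ∘ suc)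

allᵇ-sound : ∀ {A : Set} {p : A → Bool} {xs : List A} {x} →
  allᵇ p xs ≡ true → x ∈ xs → p x ≡ true
allᵇ-sound all≡true (here refl)  = proj₁ (∧-true⁻ all≡true)
allᵇ-sound all≡true (there x∈xs) = allᵇ-sound (proj₂ (∧-true⁻ all≡true)) x∈xs

allᵇ-complete : ∀ {A : Set} {p : A → Bool} (xs : List A) →
  (∀ {x} → x ∈ xs → p x ≡ true) → allᵇ p xs ≡ true
allᵇ-complete []       _     = refl
allᵇ-complete (x ∷ xs) all-p rewrite all-p (here refl) = allᵇ-complete xs (all-p ∘ there)

module _ {n} {v w : Fin n} where

  ∈-others⁺ : ∀ {u} → u ≢ v → u ≢ w → u ∈ others v w
  ∈-others⁺ {u} u≢v u≢w = ∈-filter⁺ (T? ∘ outside v w) (∈-allFin u)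
    (Equivalence.from (T-∧ {distinct u v})
      (fromWitnessFalse {a? = u ≟ v} u≢v , fromWitnessFalse {a? = u ≟ w} u≢w))

  ∈-others⁻ : ∀ {u} → u ∈ others v w → u ≢ v × u ≢ w
  ∈-others⁻ {u} u∈others
    with Equivalence.to (T-∧ {distinct u v})
           (proj₂ (∈-filter⁻ (T? ∘ outside v w) {xs = allFin n} u∈others))
  ... | u≉v , u≉w = toWitnessFalse u≉v , toWitnessFalse u≉w

  allᵇ-others⁻ : ∀ {p : Fin n → Bool} → allᵇ p (others v w) ≡ true →
    ∀ u → u ≢ v → u ≢ w → p u ≡ true
  allᵇ-others⁻ all≡true u u≢v u≢w = allᵇ-sound all≡true (∈-others⁺ u≢v u≢w)

  allᵇ-others⁺ : ∀ {p : Fin n → Bool} → (∀ u → u ≢ v → u ≢ w → p u ≡ true) →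
    allᵇ p (others v w) ≡ true
  allᵇ-others⁺ all-p = allᵇ-complete (others v w) λ u∈ →
    let u≢v , u≢w = ∈-others⁻ u∈ in all-p _ u≢v u≢w

  length-filterᵇ-others : ∀ (p : Fin n → Bool) →
    length (filterᵇ p (others v w)) ≡ count (λ u → outside v w u ∧ p u)
  length-filterᵇ-others p =
    trans (cong length (filterᵇ-filterᵇ p (outside v w) (allFin n)))
          (length-filterᵇ-tabulate (λ u → outside v w u ∧ p u) id)

module _ {n} (s : Sign n) {v w : Fin n} where

  X-≢ : X s v w ≡ true → v ≢ w
  X-≢ Xvw = distinct⇒≢ (proj₁ (∧-true⁻ Xvw))

  X-true⁻ : X s v w ≡ true → ∀ u → u ≢ v → u ≢ w → oddTri s u v w ≡ false
  X-true⁻ X≡true u u≢v u≢w = not-injective (allᵇ-others⁻ (proj₂ (∧-true⁻ X≡true)) u u≢v u≢w)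

  X-true⁺ : v ≢ w → (∀ u → u ≢ v → u ≢ w → oddTri s u v w ≡ false) → X s v w ≡ true
  X-true⁺ v≢w even rewrite distinct-≢ v≢w =
    allᵇ-others⁺ (λ u u≢v u≢w → cong not (even u u≢v u≢w))

  Y-true⁻ : Y s v w ≡ true → v ≢ w ×
    (∀ u → u ≢ v → u ≢ w → oddTri s u v w ≡ true × oddCount s u v ≡ evenCount s u v + 1)
  Y-true⁻ Y≡true = distinct⇒≢ (proj₁ (∧-true⁻ Y≡true)) , λ u u≢v u≢w →
    let odd-tri , balanced = ∧-true⁻ (allᵇ-others⁻ (proj₂ (∧-true⁻ Y≡true)) u u≢v u≢w)
    in odd-tri , ≡ᵇ⇒≡ _ _ (Equivalence.from T-≡ balanced)

  Y-true⁺ : v ≢ w →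
    (∀ u → u ≢ v → u ≢ w → oddTri s u v w ≡ true × oddCount s u v ≡ evenCount s u v + 1) →
    Y s v w ≡ true
  Y-true⁺ v≢w all-u rewrite distinct-≢ v≢w = allᵇ-others⁺ λ u u≢v u≢w →
    let odd-tri , balanced = all-u u u≢v u≢w
    in cong₂ _∧_ odd-tri (Equivalence.to T-≡ (≡⇒≡ᵇ _ _ balanced))

module _ {n} (s : Sign n) (u v : Fin n) where

  oddCount-count : oddCount s u v ≡ count (λ x → outside u v x ∧ oddTri s u v x)
  oddCount-count = length-filterᵇ-others (oddTri s u v)

  evenCount-count : evenCount s u v ≡ count (λ x → outside u v x ∧ not (oddTri s u v x))
  evenCount-count = length-filterᵇ-others (not ∘ oddTri s u v)

  oddCount+evenCount : u ≢ v → oddCount s u v + evenCount s u v + 2 ≡ n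
  oddCount+evenCount u≢v
    rewrite oddCount-count | evenCount-count | count-split (outside u v) (oddTri s u v) =
    count-outside u≢v

Y-oddCount : ∀ {n} (s : Sign n) {a b u : Fin n} → Y s a b ≡ true → u ≢ a → u ≢ b →
  suc (oddCount s u a + oddCount s u a) ≡ n
Y-oddCount s {a} {b} {u} Yab u≢a u≢b =
  balanced⇒half (oddCount+evenCount s u a u≢a) (proj₂ (proj₂ (Y-true⁻ s Yab) u u≢a u≢b))

module _ {n} {s : Sign n} (s-sym : Symmetric s) where

  oddTri-swap₁₂ : ∀ u v w → oddTri s u v w ≡ oddTri s v u w
  oddTri-swap₁₂ u v w rewrite s-sym u v = Xor.xy∙z≈xz∙y (s v u) (s v w) (s u w)

  oddTri-swap₂₃ : ∀ u v w → oddTri s u v w ≡ oddTri s u w v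
  oddTri-swap₂₃ u v w rewrite s-sym v w = Xor.xy∙z≈zy∙x (s u v) (s w v) (s u w)

  oddTri-swap₁₃ : ∀ u v w → oddTri s u v w ≡ oddTri s w v u
  oddTri-swap₁₃ u v w =
    trans (oddTri-swap₁₂ u v w) (trans (oddTri-swap₂₃ v u w) (oddTri-swap₁₂ v w u))

  -- Each edge of K₄ on {u, x, a, b} lies in exactly two of its four triangles.
  oddTri-K₄ : ∀ u x a b →
    oddTri s u a b xor oddTri s x a b ≡ oddTri s u a x xor oddTri s u b x
  oddTri-K₄ u x a b = begin
    ((s u a xor s a b) xor s u b) xor ((s x a xor s a b) xor s x b)
      ≡⟨ cong₂ _xor_ (Xor.xy∙z≈xz∙y (s u a) (s a b) (s u b))
                     (Xor.xy∙z≈xz∙y (s x a) (s a b) (s x b)) ⟩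
    ((s u a xor s u b) xor s a b) xor ((s x a xor s x b) xor s a b)
      ≡⟨ xor-cancelʳ (s u a xor s u b) (s x a xor s x b) (s a b) ⟩
    (s u a xor s u b) xor (s x a xor s x b)
      ≡⟨ Xor.interchange (s u a) (s u b) (s x a) (s x b) ⟩
    (s u a xor s x a) xor (s u b xor s x b)
      ≡⟨ cong₂ (λ p q → (s u a xor p) xor (s u b xor q)) (s-sym x a) (s-sym x b) ⟩
    (s u a xor s a x) xor (s u b xor s b x)
      ≡⟨ xor-cancelʳ (s u a xor s a x) (s u b xor s b x) (s u x) ⟨
    ((s u a xor s a x) xor s u x) xor ((s u b xor s b x) xor s u x) ∎

  oddTri-transfer : ∀ {u x a b} → oddTri s u a b ≡ true → oddTri s x a b ≡ true →
    oddTri s u a x ≡ oddTri s u b x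
  oddTri-transfer {u} {x} {a} {b} uab xab =
    xor≡false⇒≡ (trans (sym (oddTri-K₄ u x a b)) (cong₂ _xor_ uab xab))

oddTri-△ : ∀ {n} (s t : Sign n) u v w →
  oddTri (s △ t) u v w ≡ oddTri s u v w xor oddTri t u v w
oddTri-△ s t u v w = begin
  ((s u v xor t u v) xor (s v w xor t v w)) xor (s u w xor t u w)
    ≡⟨ cong (_xor (s u w xor t u w)) (Xor.interchange (s u v) (t u v) (s v w) (t v w)) ⟩
  ((s u v xor s v w) xor (t u v xor t v w)) xor (s u w xor t u w)
    ≡⟨ Xor.interchange (s u v xor s v w) (t u v xor t v w) (s u w) (t u w) ⟩
  oddTri s u v w xor oddTri t u v w ∎

△-symmetric : ∀ {n} {s t : Sign n} → Symmetric s → Symmetric t → Symmetric (s △ t)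
△-symmetric s-sym t-sym v w = cong₂ _xor_ (s-sym v w) (t-sym v w)

X-sym : ∀ {n} {s : Sign n} → Symmetric s → ∀ {v w} → X s v w ≡ true → X s w v ≡ true
X-sym {s = s} s-sym {v} {w} Xvw = X-true⁺ s (X-≢ s Xvw ∘ sym) λ u u≢w u≢v →
  trans (oddTri-swap₂₃ s-sym u w v) (X-true⁻ s Xvw u u≢v u≢w)

module _ {n} {Σ : Sign n} (Σ-sym : Symmetric Σ) where

  Y-≢ : ∀ {a b} → Y Σ a b ≡ true → a ≢ b
  Y-≢ Yab = proj₁ (Y-true⁻ Σ Yab)

  Y-oddTri : ∀ {a b u} → Y Σ a b ≡ true → u ≢ a → u ≢ b → oddTri Σ u a b ≡ true
  Y-oddTri {u = u} Yab u≢a u≢b = proj₁ (proj₂ (Y-true⁻ Σ Yab) u u≢a u≢b)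

  Y-oddCount-partner : ∀ {a b} → Y Σ a b ≡ true → oddCount Σ b a + 2 ≡ n
  Y-oddCount-partner {a} {b} Yab = begin
    oddCount Σ b a + 2      ≡⟨ cong (_+ 2) (trans (oddCount-count Σ b a) (count-cong all-odd)) ⟩
    count (outside b a) + 2 ≡⟨ count-outside (Y-≢ Yab ∘ sym) ⟩
    n                       ∎
    where
    all-odd : ∀ x → outside b a x ∧ oddTri Σ b a x ≡ outside b a x
    all-odd x = ∧-redundantʳ λ out → let x≢b , x≢a = outside-true⁻ out in
      trans (oddTri-swap₁₃ Σ-sym b a x) (Y-oddTri Yab x≢a x≢b)

  Y-oddCount-swap : ∀ {a b u} → Y Σ a b ≡ true → u ≢ a → u ≢ b →
    oddCount Σ u b ≡ oddCount Σ u a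
  Y-oddCount-swap {a} {b} {u} Yab u≢a u≢b = begin
    oddCount Σ u b
      ≡⟨ oddCount-count Σ u b ⟩
    count (λ x → outside u b x ∧ oddTri Σ u b x)
      ≡⟨ count-remove-guarded (outside u b) (oddTri Σ u b) (outside-true (u≢a ∘ sym) a≢b) ⟩
    toℕ (oddTri Σ u b a) + count (λ x → (distinct x a ∧ outside u b x) ∧ oddTri Σ u b x)
      ≡⟨ cong₂ (λ t k → toℕ t + k) (oddTri-swap₂₃ Σ-sym u a b)
               (count-guarded-cong guards-agree triangles-agree) ⟨
    toℕ (oddTri Σ u a b) + count (λ x → (distinct x b ∧ outside u a x) ∧ oddTri Σ u a x)
      ≡⟨ count-remove-guarded (outside u a) (oddTri Σ u a)
                              (outside-true (u≢b ∘ sym) (a≢b ∘ sym)) ⟨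
    count (λ x → outside u a x ∧ oddTri Σ u a x)
      ≡⟨ oddCount-count Σ u a ⟨
    oddCount Σ u a ∎
    where
    a≢b = Y-≢ Yab
    guards-agree : ∀ x → distinct x b ∧ outside u a x ≡ distinct x a ∧ outside u b x
    guards-agree x = ∧-CS.x∙yz≈z∙yx (distinct x b) (distinct x u) (distinct x a)
    triangles-agree : ∀ x → distinct x b ∧ outside u a x ≡ true →
      oddTri Σ u a x ≡ oddTri Σ u b x
    triangles-agree x guard =
      let x≉b , out = ∧-true⁻ guard ; _ , x≢a = outside-true⁻ out
      in oddTri-transfer Σ-sym (Y-oddTri Yab u≢a u≢b) (Y-oddTri Yab x≢a (distinct⇒≢ x≉b))

  Y-sym : ∀ {a b} → Y Σ a b ≡ true → Y Σ b a ≡ true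
  Y-sym {a} {b} Yab = Y-true⁺ Σ (Y-≢ Yab ∘ sym) λ u u≢b u≢a →
    trans (oddTri-swap₂₃ Σ-sym u b a) (Y-oddTri Yab u≢a u≢b) ,
    half⇒balanced (oddCount+evenCount Σ u b u≢b)
      (trans (cong (λ o → suc (o + o)) (Y-oddCount-swap Yab u≢a u≢b))
             (Y-oddCount Σ Yab u≢a u≢b))

  -- Handshake in the graph on V ∖ {a} joining x and y when xay is odd: b is joined to all
  -- n - 2 = 2m - 1 other vertices and every other vertex has degree m, so m must be odd.
  Y-half-odd : ∀ {a b m} → Y Σ a b ≡ true → suc (m + m) ≡ n → odd m ≡ true
  Y-half-odd {a} {b} {m} Yab m-half = ¬-not (false≢true ∘ sym ∘ one-odd-degree)
    where
    M : Fin n → Fin n → Bool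
    M x y = (distinct x a ∧ outside x a y) ∧ oddTri Σ x a y

    M-sym : ∀ x y → M x y ≡ M y x
    M-sym x y rewrite distinct-sym y x =
      cong₂ _∧_ (∧-CS.x∙yz≈z∙yx (distinct x a) (distinct x y) (distinct y a))
                (oddTri-swap₁₃ Σ-sym x a y)

    M-irr : ∀ x → M x x ≡ false
    M-irr x rewrite distinct-refl x | ∧-zeroʳ (distinct x a) = refl

    odd-degree : Fin n → Bool
    odd-degree u = odd (count (M u))

    degree : ∀ {u} → u ≢ a → count (M u) ≡ oddCount Σ u a
    degree {u} u≢a rewrite distinct-≢ u≢a = sym (oddCount-count Σ u a)

    degree-b-odd : odd-degree b ≡ true
    degree-b-odd = begin
      odd (count (M b))          ≡⟨ cong odd (degree (Y-≢ Yab ∘ sym)) ⟩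
      odd (oddCount Σ b a)       ≡⟨ odd-+2 (oddCount Σ b a) ⟨
      odd (oddCount Σ b a + 2)   ≡⟨ cong odd (trans (Y-oddCount-partner Yab) (sym m-half)) ⟩
      not (odd (m + m))          ≡⟨ cong not (odd-double m) ⟩
      true                       ∎

    degree-even : odd m ≡ false → ∀ {u} → u ≢ b → odd-degree u ≡ false
    degree-even odd-m {u} u≢b = case u ≟ a of λ
      { (yes refl) → cong odd (count-false λ y →
          cong (λ d → (d ∧ outside u u y) ∧ oddTri Σ u u y) (distinct-refl u))
      ; (no u≢a)   → begin
          odd (count (M u))     ≡⟨ cong odd (degree u≢a) ⟩
          odd (oddCount Σ u a)  ≡⟨ cong odd (half-unique {oddCount Σ u a} {m} (Y-oddCount Σ Yab u≢a u≢b) m-half) ⟩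
          odd m                 ≡⟨ odd-m ⟩
          false                 ∎
      }

    other-degrees-even : odd m ≡ false → ∀ u → distinct u b ∧ odd-degree u ≡ false
    other-degrees-even odd-m u with u ≟ b
    ... | yes _   = refl
    ... | no u≢b  = degree-even odd-m u≢b

    one-odd-degree : odd m ≡ false → true ≡ false
    one-odd-degree odd-m = begin
      true
        ≡⟨ cong (λ o → odd (toℕ o + 0)) degree-b-odd ⟨
      odd (toℕ (odd-degree b) + 0)
        ≡⟨ cong (λ k → odd (toℕ (odd-degree b) + k)) (count-false (other-degrees-even odd-m)) ⟨
      odd (toℕ (odd-degree b) + count (λ u → distinct u b ∧ odd-degree u))
        ≡⟨ cong odd (count-remove odd-degree b) ⟨
      odd (count odd-degree)
        ≡⟨ handshake M M-sym M-irr ⟩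
      false ∎

  Y-symmetric : Symmetric (Y Σ)
  Y-symmetric a b = ≡-by-true Y-sym Y-sym

module _ {n} (4≤n : 4 ≤ n) {Σ : Sign n} (Σ-sym : Symmetric Σ) where

  Y-unique : ∀ {a b c} → Y Σ a b ≡ true → Y Σ a c ≡ true → b ≡ c
  Y-unique {a} {b} {c} Yab Yac with b ≟ c
  ... | yes b≡c = b≡c
  ... | no b≢c  = ⊥-elim (<⇒≢ 4≤n (sym n≡3))
    where
    n≡3 : n ≡ 3
    n≡3 = full-and-half⇒3 (Y-oddCount-partner Σ-sym Yac)
                          (Y-oddCount Σ Yab (Y-≢ Σ-sym Yac ∘ sym) (b≢c ∘ sym))

  Y-uniqueˡ : ∀ {a b c} → Y Σ a c ≡ true → Y Σ b c ≡ true → a ≡ b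
  Y-uniqueˡ Yac Ybc = Y-unique (Y-sym Σ-sym Yac) (Y-sym Σ-sym Ybc)

  oddTri-Σ△Y : ∀ {u v w t yuv yvw yuw} → oddTri Σ u v w ≡ t →
    Y Σ u v ≡ yuv → Y Σ v w ≡ yvw → Y Σ u w ≡ yuw →
    oddTri (Σ △ Y Σ) u v w ≡ t xor ((yuv xor yvw) xor yuw)
  oddTri-Σ△Y {u} {v} {w} refl refl refl refl = oddTri-△ Σ (Y Σ) u v w

  X⇒Y-false : ∀ {v w} → X Σ v w ≡ true → Y Σ v w ≡ false
  X⇒Y-false {v} {w} Xvw = ¬-not λ Yvw →
    let u , u≢v , u≢w = ∃-outside (<⇒≤ 4≤n) (X-≢ Σ Xvw)
    in false≢true (trans (sym (X-true⁻ Σ Xvw u u≢v u≢w)) (Y-oddTri Σ-sym Yvw u≢v u≢w))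

  Y⇒X△ : ∀ {v w} → Y Σ v w ≡ true → X (Σ △ Y Σ) v w ≡ true
  Y⇒X△ {v} {w} Yvw = X-true⁺ (Σ △ Y Σ) (Y-≢ Σ-sym Yvw) λ u u≢v u≢w →
    oddTri-Σ△Y (Y-oddTri Σ-sym Yvw u≢v u≢w)
      (¬-not λ Yuv → u≢w (Y-unique (Y-sym Σ-sym Yuv) Yvw))
      Yvw
      (¬-not λ Yuw → u≢v (Y-unique (Y-sym Σ-sym Yuw) (Y-sym Σ-sym Yvw)))

  X⇒X△ : ∀ {v w} → X Σ v w ≡ true → X (Σ △ Y Σ) v w ≡ true
  X⇒X△ {v} {w} Xvw = X-true⁺ (Σ △ Y Σ) v≢w λ u u≢v u≢w →
    oddTri-Σ△Y (even u≢v u≢w) (¬Y-at-v u≢v u≢w) (X⇒Y-false Xvw) (¬Y-at-w u≢v u≢w)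
    where
    v≢w = X-≢ Σ Xvw
    even : ∀ {u} → u ≢ v → u ≢ w → oddTri Σ u v w ≡ false
    even = X-true⁻ Σ Xvw _
    ¬Y-at-v : ∀ {u} → u ≢ v → u ≢ w → Y Σ u v ≡ false
    ¬Y-at-v {u} u≢v u≢w = ¬-not λ Yuv → false≢true (begin
      false           ≡⟨ even u≢v u≢w ⟨
      oddTri Σ u v w  ≡⟨ oddTri-swap₂₃ Σ-sym u v w ⟩
      oddTri Σ u w v  ≡⟨ oddTri-swap₁₂ Σ-sym u w v ⟩
      oddTri Σ w u v  ≡⟨ Y-oddTri Σ-sym Yuv (u≢w ∘ sym) (v≢w ∘ sym) ⟩
      true            ∎)
    ¬Y-at-w : ∀ {u} → u ≢ v → u ≢ w → Y Σ u w ≡ false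
    ¬Y-at-w {u} u≢v u≢w = ¬-not λ Yuw → false≢true (begin
      false           ≡⟨ even u≢v u≢w ⟨
      oddTri Σ u v w  ≡⟨ oddTri-swap₁₂ Σ-sym u v w ⟩
      oddTri Σ v u w  ≡⟨ Y-oddTri Σ-sym Yuw (u≢v ∘ sym) v≢w ⟩
      true            ∎)

  -- With a matched to v, the only odd triangles on wv besides wva pass through the partner of w,
  -- so the odd number (n - 1)/2 of them is at most 2, forcing n = 3.
  X△-no-Y-neighbour : ∀ {v w} → Y Σ v w ≡ false → X (Σ △ Y Σ) v w ≡ true →
    ∀ a → Y Σ a v ≡ false
  X△-no-Y-neighbour {v} {w} ¬Yvw X△vw a = ¬-not λ Yav → <⇒≢ 4≤n (sym (n≡3 Yav))
    where
    n≡3 : Y Σ a v ≡ true → n ≡ 3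
    n≡3 Yav = small-odd-half⇒3 (Y-half-odd Σ-sym {m = oddCount Σ w v} Yva half) bound half
      where
      Yva : Y Σ v a ≡ true
      Yva = Y-sym Σ-sym Yav
      a≢w : a ≢ w
      a≢w refl = false≢true (trans (sym ¬Yvw) Yva)
      half : suc (oddCount Σ w v + oddCount Σ w v) ≡ n
      half = Y-oddCount Σ Yva (X-≢ (Σ △ Y Σ) X△vw ∘ sym) (a≢w ∘ sym)
      partner : ∀ x → (distinct x a ∧ outside w v x) ∧ oddTri Σ w v x ≡ true → Y Σ x w ≡ true
      partner x guarded-odd =
        let (x≉a , out) , wvx = map₁ ∧-true⁻ (∧-true⁻ guarded-odd)
            x≢w , x≢v = outside-true⁻ out
            ¬Yxv = ¬-not λ Yxv → distinct⇒≢ x≉a (Y-uniqueˡ Yxv Yav)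
            xvw = trans (oddTri-swap₁₃ Σ-sym x v w) wvx
        in not-injective (trans (sym (oddTri-Σ△Y xvw ¬Yxv ¬Yvw refl)) (X-true⁻ (Σ △ Y Σ) X△vw x x≢v x≢w))
      bound : oddCount Σ w v ≤ 2
      bound = ≤-trans
        (≤-reflexive (trans (oddCount-count Σ w v)
                            (count-remove-guarded (outside w v) (oddTri Σ w v)
                                                  (outside-true a≢w (Y-≢ Σ-sym Yav)))))
        (+-mono-≤ (toℕ≤1 (oddTri Σ w v a))
                  (count-≤1 _ λ x y px py → Y-uniqueˡ (partner x px) (partner y py)))

  X△⇒X : ∀ {v w} → X (Σ △ Y Σ) v w ≡ true → Y Σ v w ≡ false → X Σ v w ≡ true
  X△⇒X {v} {w} X△vw ¬Yvw = X-true⁺ Σ (X-≢ (Σ △ Y Σ) X△vw) λ u u≢v u≢w → begin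
    oddTri Σ u v w                                   ≡⟨ xor-identityʳ (oddTri Σ u v w) ⟨
    oddTri Σ u v w xor ((false xor false) xor false) ≡⟨ oddTri-Σ△Y refl (no-Y-at-v u) ¬Yvw (no-Y-at-w u) ⟨
    oddTri (Σ △ Y Σ) u v w                           ≡⟨ X-true⁻ (Σ △ Y Σ) X△vw u u≢v u≢w ⟩
    false                                            ∎
    where
    no-Y-at-v : ∀ u → Y Σ u v ≡ false
    no-Y-at-v = X△-no-Y-neighbour ¬Yvw X△vw
    no-Y-at-w : ∀ u → Y Σ u w ≡ false
    no-Y-at-w = X△-no-Y-neighbour (trans (Y-symmetric Σ-sym w v) ¬Yvw)
                                  (X-sym (△-symmetric Σ-sym (Y-symmetric Σ-sym)) X△vw)

  X∨Y≡X△ : ∀ {v w} → (X Σ v w ∨ Y Σ v w) ≡ X (Σ △ Y Σ) v w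
  X∨Y≡X△ {v} {w} = ≡-by-true ([ X⇒X△ , Y⇒X△ ] ∘ ∨-true⁻ {X Σ v w}) X△⇒X∨Y
    where
    X△⇒X∨Y : X (Σ △ Y Σ) v w ≡ true → X Σ v w ∨ Y Σ v w ≡ true
    X△⇒X∨Y X△vw with Y Σ v w Bool.≟ true
    ... | yes Yvw = trans (cong (X Σ v w ∨_) Yvw) (∨-zeroʳ (X Σ v w))
    ... | no ¬Yvw = cong (_∨ Y Σ v w) (X△⇒X X△vw (¬-not ¬Yvw))

  -- Away from z′ the Y-edges of Σ miss the triangles on zv, so only zvz′ changes parity.
  Y△-count-gap : ∀ {v z z′} → (∀ c → Y Σ v c ≡ false) → Y Σ z z′ ≡ true → v ≢ z → v ≢ z′ →
    oddCount Σ v z ≡ suc (oddCount (Σ △ Y Σ) z v)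
  Y△-count-gap {v} {z} {z′} v-alone Yzz′ v≢z v≢z′ = begin
    oddCount Σ v z
      ≡⟨ oddCount-count Σ v z ⟩
    count (λ x → outside v z x ∧ oddTri Σ v z x)
      ≡⟨ count-remove-guarded (outside v z) (oddTri Σ v z) (outside-true (v≢z′ ∘ sym) z′≢z) ⟩
    toℕ (oddTri Σ v z z′) + count (λ x → (distinct x z′ ∧ outside v z x) ∧ oddTri Σ v z x)
      ≡⟨ cong₂ (λ t k → toℕ t + k) (Y-oddTri Σ-sym Yzz′ v≢z v≢z′)
               (count-guarded-cong guards-agree triangles-agree) ⟩
    suc (toℕ false + rest)
      ≡⟨ cong (λ t → suc (toℕ t + rest)) zvz′-even ⟨
    suc (toℕ (oddTri (Σ △ Y Σ) z v z′) + rest)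
      ≡⟨ cong suc (count-remove-guarded (outside z v) (oddTri (Σ △ Y Σ) z v)
                                        (outside-true z′≢z (v≢z′ ∘ sym))) ⟨
    suc (count (λ x → outside z v x ∧ oddTri (Σ △ Y Σ) z v x))
      ≡⟨ cong suc (oddCount-count (Σ △ Y Σ) z v) ⟨
    suc (oddCount (Σ △ Y Σ) z v) ∎
    where
    rest : ℕ
    rest = count (λ x → (distinct x z′ ∧ outside z v x) ∧ oddTri (Σ △ Y Σ) z v x)
    z′≢z : z′ ≢ z
    z′≢z = Y-≢ Σ-sym Yzz′ ∘ sym
    ¬Yzv : Y Σ z v ≡ false
    ¬Yzv = trans (Y-symmetric Σ-sym z v) (v-alone z)
    zvz′-even : oddTri (Σ △ Y Σ) z v z′ ≡ false
    zvz′-even = oddTri-Σ△Y (trans (oddTri-swap₁₂ Σ-sym z v z′) (Y-oddTri Σ-sym Yzz′ v≢z v≢z′))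
                           ¬Yzv (v-alone z′) Yzz′
    guards-agree : ∀ x → distinct x z′ ∧ outside v z x ≡ distinct x z′ ∧ outside z v x
    guards-agree x = cong (distinct x z′ ∧_) (∧-comm (distinct x v) (distinct x z))
    triangles-agree : ∀ x → distinct x z′ ∧ outside v z x ≡ true →
      oddTri Σ v z x ≡ oddTri (Σ △ Y Σ) z v x
    triangles-agree x guard =
      let x≉z′ , _ = ∧-true⁻ guard
          ¬Yzx = ¬-not λ Yzx → distinct⇒≢ x≉z′ (Y-unique Yzx Yzz′)
      in begin
        oddTri Σ v z x                                     ≡⟨ oddTri-swap₁₂ Σ-sym v z x ⟩
        oddTri Σ z v x                                     ≡⟨ xor-identityʳ (oddTri Σ z v x) ⟨
        oddTri Σ z v x xor ((false xor false) xor false)   ≡⟨ oddTri-Σ△Y refl ¬Yzv (v-alone x) ¬Yzx ⟨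
        oddTri (Σ △ Y Σ) z v x                             ∎

  Y△-odd : ∀ {v w u} → Y (Σ △ Y Σ) v w ≡ true → u ≢ v → u ≢ w →
    oddTri (Σ △ Y Σ) u v w ≡ true
  Y△-odd {u = u} Y△vw u≢v u≢w = proj₁ (proj₂ (Y-true⁻ (Σ △ Y Σ) Y△vw) u u≢v u≢w)

  ¬Y△-at-matched : ∀ {v w c} → Y (Σ △ Y Σ) v w ≡ true → Y Σ v c ≡ true → ⊥
  ¬Y△-at-matched {v} {w} {c} Y△vw Yvc with c ≟ w
  ... | yes refl =
    let u , u≢v , u≢w = ∃-outside (<⇒≤ 4≤n) (Y-≢ Σ-sym Yvc)
    in false≢true (trans (sym (X-true⁻ (Σ △ Y Σ) (Y⇒X△ Yvc) u u≢v u≢w)) (Y△-odd Y△vw u≢v u≢w))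
  ... | no c≢w = false≢true (trans (sym cvw-even) (Y△-odd Y△vw c≢v c≢w))
    where
    v≢w = proj₁ (Y-true⁻ (Σ △ Y Σ) Y△vw)
    c≢v = Y-≢ Σ-sym Yvc ∘ sym
    cvw-even : oddTri (Σ △ Y Σ) c v w ≡ false
    cvw-even = oddTri-Σ△Y
      (trans (oddTri-swap₁₃ Σ-sym c v w) (Y-oddTri Σ-sym Yvc (v≢w ∘ sym) (c≢w ∘ sym)))
      (Y-sym Σ-sym Yvc)
      (¬-not λ Yvw → c≢w (Y-unique Yvc Yvw))
      (¬-not λ Ycw → v≢w (Y-unique (Y-sym Σ-sym Yvc) Ycw))

  ¬Y△-at-unmatched : ∀ {v w z z′} → Y (Σ △ Y Σ) v w ≡ true → (∀ c → Y Σ v c ≡ false) →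
    Y Σ z z′ ≡ true → z ≢ w → ⊥
  ¬Y△-at-unmatched {v} {w} {z} {z′} Y△vw v-alone Yzz′ z≢w =
    1+n≢n (trans (sym (Y△-count-gap v-alone Yzz′ v≢z v≢z′))
                 (sym (half-unique {k = oddCount Σ v z} Δ-half Σ-half)))
    where
    v≢z : v ≢ z
    v≢z refl = false≢true (trans (sym (v-alone z′)) Yzz′)
    v≢z′ : v ≢ z′
    v≢z′ refl = false≢true (trans (sym (v-alone z)) (Y-sym Σ-sym Yzz′))
    Δ-half = Y-oddCount (Σ △ Y Σ) Y△vw (v≢z ∘ sym) z≢w
    Σ-half = Y-oddCount Σ Yzz′ v≢z v≢z′

  Y△-empty : ∀ {a b} → Y Σ a b ≡ true → ∀ {v w} → Y (Σ △ Y Σ) v w ≢ true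
  Y△-empty {a} {b} Yab {v} {w} Y△vw with search (Y Σ v) | a ≟ w
  ... | inj₁ (_ , Yvc) | _        = ¬Y△-at-matched Y△vw Yvc
  ... | inj₂ v-alone   | no a≢w   = ¬Y△-at-unmatched Y△vw v-alone Yab a≢w
  ... | inj₂ v-alone   | yes refl = ¬Y△-at-unmatched Y△vw v-alone (Y-sym Σ-sym Yab) (Y-≢ Σ-sym Yab ∘ sym)

lemma3p5 : (n : ℕ) → 4 ≤ n → (Σ : Sign n) → Symmetric Σ →
    (∃₂ λ (v w : Fin n) → v ≢ w × Y Σ v w ≡ true) →
    ((v w : Fin n) → v ≢ w → (X Σ v w ∨ Y Σ v w) ≡ X (Σ △ Y Σ) v w)
    × ((v w : Fin n) → v ≢ w → Y (Σ △ Y Σ) v w ≡ false)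
lemma3p5 n 4≤n Σ Σ-sym (_ , _ , _ , Yab) =
  (λ v w _ → X∨Y≡X△ 4≤n Σ-sym) ,
  (λ v w _ → ¬-not (Y△-empty 4≤n Σ-sym Yab))
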